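{- Let $C$ be a set and $A,B\subseteq\omega$ be infinite sets. Then $A$ and $B$ are both $C$-hyperimmune if and only if the bifamily $\mathcal H(A,B)$ is $C$-2-hyperimmune.
   Context: $\mathcal H(A,B)$ is the collection of all pairs $(E,F)$ of finite sets with $E\subseteq\overline A$ and $F\subseteq\overline B$. For a finite set $E$ and integer $n$, $E>n$ means every element of $E$ exceeds $n$. An infinite set $H$ is $C$-hyperimmune if for every $C$-computable sequence (given by canonical indices) of finite sets $V_0,V_1,\dots$ with $V_n>n$, there is some $n$ with $V_n\subseteq\overline H$. A biarray is a family $\langle E_n,F_{n,m}:n,m\in\omega\rangle$ of finite sets with $E_n>n$ and $F_{n,m}>m$; it is $C$-computable if the function giving the canonical indices of $E_n$ and $F_{n,m}$ is $C$-computable. It meets a collection $\mathcal H$ of pairs if $(E_n,F_{n,m})\in\mathcal H$ for some $n,m$. $\mathcal H$ is $C$-2-hyperimmune if every $C$-computable biarray meets $\mathcal H$. -}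

module Defs where

open import Data.Nat using (ℕ; zero; suc; _<_; _≤_; _/_; _%_)
open import Data.Bool using (Bool; true; false)
open import Data.Fin using (Fin)
open import Data.Vec using (Vec; []; _∷_; lookup)
open import Data.Product using (Σ; _×_; _,_; ∃; ∃-syntax)
open import Relation.Binary.PropositionalEquality using (_≡_)

SetN : Set
SetN = ℕ → Bool

Infinite : SetN → Set
Infinite A = ∀ n → ∃[ m ] (n ≤ m × A m ≡ true)

-- Canonical indices of finite sets: D_k = { i | bit i of k is 1 }.

_∈D_ : ℕ → ℕ → Set
zero  ∈D k = k % 2 ≡ 1
suc i ∈D k = i ∈D (k / 2)

D⊆∁ : ℕ → SetN → Set
D⊆∁ k A = ∀ i → i ∈D k → A i ≡ false

D> : ℕ → ℕ → Set
D> k n = ∀ i → i ∈D k → n < i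

data Code : ℕ → Set where
  zer    : ∀ {k} → Code k
  succ   : Code 1
  proj   : ∀ {k} → Fin k → Code k
  orc    : Code 1
  comp   : ∀ {k m} → Code m → Vec (Code k) m → Code k
  prec   : ∀ {k} → Code k → Code (suc (suc k)) → Code (suc k)
  mu     : ∀ {k} → Code (suc k) → Code k

χ : Bool → ℕ
χ true  = 1
χ false = 0

mutual
  data Eval (C : SetN) : ∀ {k} → Code k → Vec ℕ k → ℕ → Set where
    e-zer  : ∀ {k} {xs : Vec ℕ k} → Eval C zer xs 0
    e-succ : ∀ {x} → Eval C succ (x ∷ []) (suc x)
    e-proj : ∀ {k} {i : Fin k} {xs} → Eval C (proj i) xs (lookup xs i)
    e-orc  : ∀ {x} → Eval C orc (x ∷ []) (χ (C x))
    e-comp : ∀ {k m} {f : Code m} {gs : Vec (Code k) m} {xs ys y}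
           → EvalVec C gs xs ys → Eval C f ys y → Eval C (comp f gs) xs y
    e-prec0 : ∀ {k} {f : Code k} {g} {xs y}
            → Eval C f xs y → Eval C (prec f g) (0 ∷ xs) y
    e-precS : ∀ {k} {f : Code k} {g} {n xs r y}
            → Eval C (prec f g) (n ∷ xs) r → Eval C g (n ∷ r ∷ xs) y
            → Eval C (prec f g) (suc n ∷ xs) y
    e-mu   : ∀ {k} {f : Code (suc k)} {xs y}
           → Eval C f (y ∷ xs) 0
           → (∀ i → i < y → ∃[ v ] Eval C f (i ∷ xs) (suc v))
           → Eval C (mu f) xs y

  data EvalVec (C : SetN) {k : ℕ} : ∀ {m} → Vec (Code k) m → Vec ℕ k → Vec ℕ m → Set where
    [] : ∀ {xs} → EvalVec C [] xs []
    _∷_ : ∀ {m} {g : Code k} {gs : Vec (Code k) m} {xs y ys}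
        → Eval C g xs y → EvalVec C gs xs ys → EvalVec C (g ∷ gs) xs (y ∷ ys)

Computable₁ : SetN → (ℕ → ℕ) → Set
Computable₁ C f = ∃[ e ] ∀ n → Eval C {1} e (n ∷ []) (f n)

Computable₂ : SetN → (ℕ → ℕ → ℕ) → Set
Computable₂ C f = ∃[ e ] ∀ n m → Eval C {2} e (n ∷ m ∷ []) (f n m)

Hyperimmune : SetN → SetN → Set
Hyperimmune C H =
  Infinite H ×
  (∀ (V : ℕ → ℕ) → Computable₁ C V → (∀ n → D> (V n) n) →
     ∃[ n ] D⊆∁ (V n) H)

-- A collection of pairs of finite sets, given via canonical indices.
Bifamily : Set₁
Bifamily = ℕ → ℕ → Set

-- A C-computable biarray: E n = D_(e n), F n m = D_(f n m).
record Biarray (C : SetN) : Set where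
  field
    e : ℕ → ℕ
    f : ℕ → ℕ → ℕ
    e-computable : Computable₁ C e
    f-computable : Computable₂ C f
    e-> : ∀ n → D> (e n) n
    f-> : ∀ n m → D> (f n m) m

Meets : ∀ {C} → Biarray C → Bifamily → Set
Meets b 𝓗 = ∃[ n ] ∃[ m ] 𝓗 (Biarray.e b n) (Biarray.f b n m)

TwoHyperimmune : SetN → Bifamily → Set
TwoHyperimmune C 𝓗 = ∀ (b : Biarray C) → Meets b 𝓗

𝓗 : SetN → SetN → Bifamily
𝓗 A B k l = D⊆∁ k A × D⊆∁ l B

-- Forward: hyperimmunity of A yields a row n with E_n ⊆ ∁A; the n-th row
-- m ↦ F_{n,m} is again a C-computable array, so hyperimmunity of B yields m
-- with F_{n,m} ⊆ ∁B. Backward: pad a C-computable array with empty sets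
-- (canonical index 0, which exceeds every bound vacuously) to a biarray whose
-- E-part, resp. F-part, is the array; a pair in 𝓗(A,B) met by it gives the
-- required member inside ∁A, resp. ∁B.
module Submission where

open import Defs
open import Data.Product using (_×_; _,_; ∃-syntax)
open import Function.Bundles using (_⇔_; mk⇔)
open import Data.Nat using (ℕ; zero; suc)
open import Data.Fin using () renaming (zero to fzero; suc to fsuc)
open import Data.Vec using (Vec; []; _∷_)
open import Data.Empty using (⊥-elim)
open import Relation.Nullary using (¬_)

∉D0 : ∀ i → ¬ i ∈D 0
∉D0 zero    ()
∉D0 (suc i) = ∉D0 i

D0> : ∀ n → D> 0 n
D0> n i i∈D0 = ⊥-elim (∉D0 i i∈D0)

const : ∀ {k} → ℕ → Code k
const zero    = zer
const (suc c) = comp succ (const c ∷ [])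

eval-const : ∀ {C k} (c : ℕ) (xs : Vec ℕ k) → Eval C (const c) xs c
eval-const zero    xs = e-zer
eval-const (suc c) xs = e-comp (eval-const c xs ∷ []) e-succ

const-computable₁ : ∀ {C} c → Computable₁ C (λ _ → c)
const-computable₁ c = const c , λ n → eval-const c (n ∷ [])

const-computable₂ : ∀ {C} c → Computable₂ C (λ _ _ → c)
const-computable₂ c = const c , λ n m → eval-const c (n ∷ m ∷ [])

row-computable : ∀ {C f} → Computable₂ C f → ∀ n → Computable₁ C (f n)
row-computable (e , eval-e) n =
  comp e (const n ∷ proj fzero ∷ []) ,
  λ m → e-comp (eval-const n (m ∷ []) ∷ e-proj ∷ []) (eval-e n m)

ignoreˡ-computable : ∀ {C g} → Computable₁ C g → Computable₂ C (λ _ m → g m)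
ignoreˡ-computable (e , eval-e) =
  comp e (proj (fsuc fzero) ∷ []) , λ n m → e-comp (e-proj ∷ []) (eval-e m)

-- Hyperimmune C H is definitionally Infinite H × AvoidsEveryArray C H.
AvoidsEveryArray : SetN → SetN → Set
AvoidsEveryArray C H =
  ∀ (V : ℕ → ℕ) → Computable₁ C V → (∀ n → D> (V n) n) → ∃[ n ] D⊆∁ (V n) H

𝓗-twoHyperimmune : ∀ {C A B} → AvoidsEveryArray C A → AvoidsEveryArray C B →
                   TwoHyperimmune C (𝓗 A B)
𝓗-twoHyperimmune avoidsA avoidsB b
  with avoidsA (Biarray.e b) (Biarray.e-computable b) (Biarray.e-> b)
... | n , Eₙ⊆∁A
  with avoidsB (Biarray.f b n) (row-computable (Biarray.f-computable b) n) (Biarray.f-> b n)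
... | m , Fₙₘ⊆∁B = n , m , Eₙ⊆∁A , Fₙₘ⊆∁B

E-biarray : ∀ {C} (V : ℕ → ℕ) → Computable₁ C V → (∀ n → D> (V n) n) → Biarray C
E-biarray V V-computable V> = record
  { e = V ; f = λ _ _ → 0
  ; e-computable = V-computable ; f-computable = const-computable₂ 0
  ; e-> = V> ; f-> = λ _ → D0> }

F-biarray : ∀ {C} (V : ℕ → ℕ) → Computable₁ C V → (∀ n → D> (V n) n) → Biarray C
F-biarray V V-computable V> = record
  { e = λ _ → 0 ; f = λ _ m → V m
  ; e-computable = const-computable₁ 0 ; f-computable = ignoreˡ-computable V-computable
  ; e-> = D0> ; f-> = λ _ → V> }

twoHyperimmune-avoidsˡ : ∀ {C A B} → TwoHyperimmune C (𝓗 A B) → AvoidsEveryArray C A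
twoHyperimmune-avoidsˡ 2hi V V-computable V>
  with 2hi (E-biarray V V-computable V>)
... | n , _ , Vₙ⊆∁A , _ = n , Vₙ⊆∁A

twoHyperimmune-avoidsʳ : ∀ {C A B} → TwoHyperimmune C (𝓗 A B) → AvoidsEveryArray C B
twoHyperimmune-avoidsʳ 2hi V V-computable V>
  with 2hi (F-biarray V V-computable V>)
... | _ , m , _ , Vₘ⊆∁B = m , Vₘ⊆∁B

lemma2p4 : (C A B : SetN) → Infinite A → Infinite B →
           (Hyperimmune C A × Hyperimmune C B) ⇔ TwoHyperimmune C (𝓗 A B)
lemma2p4 C A B infA infB = mk⇔
  (λ ((_ , avoidsA) , (_ , avoidsB)) → 𝓗-twoHyperimmune avoidsA avoidsB)
  (λ 2hi → (infA , twoHyperimmune-avoidsˡ 2hi) , (infB , twoHyperimmune-avoidsʳ 2hi))
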